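{- In the setting below, let $\gamma$ be a proper and invertible generalizer. If $\mathrm{GCG}_{\simeq}(\Phi,\psi,\gamma)$ maintains Property 3 (for the generalizer $\gamma$) as an invariant, then it also maintains Property 4 as an invariant.
   Context: LTS setting. A labeled transition system (LTS) is $\langle\Sigma,Q,Q_0,\Delta\rangle$ (finite labels $\Sigma$, finite states $Q$, initial states $Q_0\subseteq Q$, $\Delta\subseteq Q\times\Sigma\times Q$). Fix an LTS $M_0=\langle\Sigma,Q,Q_0,\Delta_0\rangle$; a completion of $M_0$ is an LTS with the same $\Sigma,Q,Q_0$ and a transition relation $\Delta\supseteq\Delta_0$. Let $V=\{x_{p,a,q}: p,q\in Q, a\in\Sigma\}$; an assignment $\sigma:V\to\{0,1\}$ encodes the LTS $M_\sigma$ with $\Sigma,Q,Q_0$ and $\Delta_\sigma=\{(p,a,q):\sigma(x_{p,a,q})=1\}$. $\Phi$ is a propositional formula over $V$ that implies $\bigwedge_{(p,a,q)\in\Delta_0}x_{p,a,q}$. Let $A$ be the set of non-initial states of $M_0$ with no incoming or outgoing transitions in $\Delta_0$. For assignments $\sigma,\rho$ satisfying $\Phi$, $\sigma\simeq\rho$ means there is a bijection $f:Q\to Q$ with $f(q)=q$ for $q\notin A$ such that $(p,a,q)\in\Delta_\sigma$ iff $(f(p),a,f(q))\in\Delta_\rho$. For $\rho\models\Phi$, $[\rho]=\{\sigma:\sigma\models\Phi,\ \sigma\simeq\rho\}$, also viewed as the formula satisfied exactly by its elements. $\psi$ is a specification with satisfaction relation $M\models\psi$, assumed invariant under isomorphism: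 if $\sigma\simeq\rho$ then $M_\sigma\models\psi$ iff $M_\rho\models\psi$. An assignment is identified with the formula satisfied by exactly it. A generalizer maps assignments to formulas over $V$; $\gamma$ is proper if for every $\sigma\models\Phi$ with $M_\sigma\not\models\psi$: $\sigma\models\gamma(\sigma)$, and no $\rho$ with $\rho\models\Phi$, $M_\rho\models\psi$ satisfies $\gamma(\sigma)$. For an assignment $\tau$, $\gamma^{ -1}(\tau)$ is the formula satisfied exactly by those $\sigma$ with $\tau\models\gamma(\sigma)$. A formula $\varphi$ subsumes $\varphi'$ up to isomorphism if for every $\sigma\models\varphi$ there is $\sigma'\models\varphi'$ with $\sigma'\simeq\sigma$; they are equivalent up to isomorphism if each subsumes the other. $\gamma$ is invertible if for all $\tau,\tau'$ satisfying $\Phi$ with $\tau\simeq\tau'$, $\gamma^{ -1}(\tau)$ and $\gamma^{ -1}(\tau')$ are equivalent up to isomorphism. Algorithm $\mathrm{GCG}_{\simeq}(\Phi,\psi,g)$ for a generalizer $g$: keep $\Phi_{cur}:=\Phi$; while $\Phi_{cur}$ is satisfiable, pick an arbitrary $\sigma\models\Phi_{cur}$; if $M_\sigma\models\psi$, output $\sigma$ (a solution) and set $\Phi_{cur}:=\Phi_{cur}\wedge\neg[\sigma]$; else set $\Phi_{cur}:=\Phi_{cur}\wedge\neg g(\sigma)$. In an execution, $\mathsf{Sol}$ is the set of solutions output so far and $\mathsf{Pruned}$ is the set of all assignments satisfying some formula $\varphi$ for which a step $\Phi_{cur}:=\Phi_{cur}\wedge\neg\varphi$ has been performed so far. Property 3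 (invariant, for generalizer $g$): in every execution, at every point, for every $\sigma$ for which the step $\Phi_{cur}:=\Phi_{cur}\wedge\neg g(\sigma)$ has been performed so far and every $\rho\simeq\sigma$, every assignment satisfying $g(\rho)$ belongs to $\mathsf{Pruned}$. Property 4 (invariant): in every execution, at every point, for all $\tau,\tau'$ satisfying $\Phi$ with $\tau\in\mathsf{Pruned}$ and $\tau'\simeq\tau$, we have $\tau'\in\mathsf{Pruned}$ or $\tau'\in\mathsf{Sol}$. -}

module Defs where

open import Data.Nat using (ℕ)
open import Data.Fin using (Fin)
open import Data.Bool using (Bool; true; false)
open import Data.Product using (Σ; ∃; ∃-syntax; _×_; _,_)
open import Data.Sum using (_⊎_)
open import Data.List using (List; []; _∷_)
open import Data.List.Relation.Unary.Any using (Any)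
open import Data.Fin.Permutation using (Permutation′; _⟨$⟩ʳ_)
open import Relation.Nullary using (¬_)
open import Relation.Binary.PropositionalEquality using (_≡_)
open import Function.Bundles using (_⇔_)

-- States Q = Fin n, labels Σ = Fin k.
record LTS (n k : ℕ) : Set where
  field
    initial : Fin n → Bool                 -- Q₀ as a characteristic function
    trans   : Fin n → Fin k → Fin n → Bool -- Δ as a characteristic function

-- An assignment σ : V → {0,1}, V = { x_{p,a,q} }.
Assignment : ℕ → ℕ → Set
Assignment n k = Fin n → Fin k → Fin n → Bool

-- Propositional formulas over the finite set V, identified with their
-- sets of models (every set of assignments is definable, V being finite).
Formula : ℕ → ℕ → Set₁
Formula n k = Assignment n k → Set

_⊨_ : ∀ {n k} → Assignment n k → Formula n k → Set
σ ⊨ φ = φ σ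

Generalizer : ℕ → ℕ → Set₁
Generalizer n k = Assignment n k → Formula n k

Spec : ℕ → ℕ → Set₁
Spec n k = LTS n k → Set

module _ {n k : ℕ} (M₀ : LTS n k) where
  open LTS M₀

  M[_] : Assignment n k → LTS n k
  M[ σ ] = record { initial = initial ; trans = σ }

  ImpliesΔ₀ : Formula n k → Set
  ImpliesΔ₀ Φ = ∀ σ → σ ⊨ Φ → ∀ p a q → trans p a q ≡ true → σ p a q ≡ true

  InA : Fin n → Set
  InA q = initial q ≡ false × (∀ a p → trans q a p ≡ false) × (∀ p a → trans p a q ≡ false)

  _≃_ : Assignment n k → Assignment n k → Set
  σ ≃ ρ = Σ (Permutation′ n) λ f →
            (∀ q → ¬ InA q → f ⟨$⟩ʳ q ≡ q) ×
            (∀ p a q → (σ p a q ≡ true) ⇔ (ρ (f ⟨$⟩ʳ p) a (f ⟨$⟩ʳ q) ≡ true))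

  module _ (Φ : Formula n k) where

    [_] : Assignment n k → Formula n k
    [ ρ ] σ = σ ⊨ Φ × σ ≃ ρ

    IsoInvariant : Spec n k → Set
    IsoInvariant ψ = ∀ σ ρ → σ ⊨ Φ → ρ ⊨ Φ → σ ≃ ρ → ψ M[ σ ] ⇔ ψ M[ ρ ]

    Subsumes : Formula n k → Formula n k → Set
    Subsumes φ φ' = ∀ σ → σ ⊨ φ → ∃[ σ' ] (σ' ⊨ φ' × σ' ≃ σ)

    EquivUpToIso : Formula n k → Formula n k → Set
    EquivUpToIso φ φ' = Subsumes φ φ' × Subsumes φ' φ

    _⁻¹[_] : Generalizer n k → Assignment n k → Formula n k
    (γ ⁻¹[ τ ]) σ = τ ⊨ γ σ

    Invertible : Generalizer n k → Set
    Invertible γ = ∀ τ τ' → τ ⊨ Φ → τ' ⊨ Φ → τ ≃ τ' → EquivUpToIso (γ ⁻¹[ τ ]) (γ ⁻¹[ τ' ])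

    module _ (ψ : Spec n k) where

      Proper : Generalizer n k → Set
      Proper γ = ∀ σ → σ ⊨ Φ → ¬ ψ M[ σ ] →
                   (σ ⊨ γ σ) × (∀ ρ → ρ ⊨ Φ → ψ M[ ρ ] → ¬ (ρ ⊨ γ σ))

      module _ (g : Generalizer n k) where

        -- An iteration of GCG≃(Φ,ψ,g) is recorded by the assignment picked
        -- and which branch was taken.
        data Event : Set where
          sol : Assignment n k → Event   -- output σ, Φcur := Φcur ∧ ¬[σ]
          gen : Assignment n k → Event   -- Φcur := Φcur ∧ ¬ g(σ)

        prunedBy : Event → Formula n k
        prunedBy (sol σ) = [ σ ]
        prunedBy (gen σ) = g σ

        -- Executions so far: lists of events, most recent first.
        Pruned : List Event → Formula n k
        Pruned tr τ = Any (λ e → τ ⊨ prunedBy e) tr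

        Sol : List Event → Formula n k
        Sol tr τ = Any (λ e → e ≡ sol τ) tr

        Φcur : List Event → Formula n k
        Φcur tr σ = σ ⊨ Φ × ¬ Pruned tr σ

        -- The points reachable in some execution (σ arbitrary model of Φcur).
        data Reachable : List Event → Set where
          start   : Reachable []
          stepSol : ∀ {tr σ} → Reachable tr → σ ⊨ Φcur tr → ψ M[ σ ] →
                      Reachable (sol σ ∷ tr)
          stepGen : ∀ {tr σ} → Reachable tr → σ ⊨ Φcur tr → ¬ ψ M[ σ ] →
                      Reachable (gen σ ∷ tr)

        Property3 : List Event → Set
        Property3 tr = ∀ σ → Any (λ e → e ≡ gen σ) tr →
                         ∀ ρ → ρ ≃ σ → ∀ τ → τ ⊨ g ρ → Pruned tr τ

        Property4 : List Event → Set
        Property4 tr = ∀ τ τ' → τ ⊨ Φ → τ' ⊨ Φ → Pruned tr τ → τ' ≃ τ →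
                         Pruned tr τ' ⊎ Sol tr τ'

        MaintainsInvariant : (List Event → Set) → Set
        MaintainsInvariant P = ∀ tr → Reachable tr → P tr

{-# OPTIONS --safe #-}
module Submission where

-- A pruned τ lies in [σ] for a solution σ, or satisfies γ(σ) for a generalised σ.
-- In the first case τ' ≃ τ ≃ σ puts τ' in [σ] as well. In the second, σ is a model
-- of γ⁻¹(τ); invertibility yields σ' ≃ σ with τ' ⊨ γ(σ'), and Property 3 at σ prunes
-- every model of γ(σ').

open import Defs
open import Data.Nat using (ℕ)
open import Data.Product using (_,_; proj₂)
open import Data.Sum using (inj₁)
import Data.List.Relation.Unary.Any as Any
open import Data.List.Membership.Propositional using (_∈_; find; lose)
open import Data.Fin.Permutation using (_⟨$⟩ʳ_; _∘ₚ_)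
open import Relation.Binary.PropositionalEquality using (sym; trans; cong)
open import Function.Bundles using (mk⇔; Equivalence)

module _ {n k : ℕ} (M₀ : LTS n k) where

  ≃-trans : ∀ {σ ρ τ} → _≃_ M₀ σ ρ → _≃_ M₀ ρ τ → _≃_ M₀ σ τ
  ≃-trans (f , f-fixes , f-iso) (h , h-fixes , h-iso) =
    f ∘ₚ h ,
    (λ q q∉A → trans (cong (h ⟨$⟩ʳ_) (f-fixes q q∉A)) (h-fixes q q∉A)) ,
    λ p a q → mk⇔
      (λ σpaq → Equivalence.to (h-iso _ a _) (Equivalence.to (f-iso p a q) σpaq))
      (λ τpaq → Equivalence.from (f-iso p a q) (Equivalence.from (h-iso _ a _) τpaq))

  module _ (Φ : Formula n k) where

    [-]-closed : ∀ {σ τ τ'} → τ ⊨ [_] M₀ Φ σ → τ' ⊨ Φ → _≃_ M₀ τ' τ → τ' ⊨ [_] M₀ Φ σ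
    [-]-closed {σ} {τ} {τ'} (_ , τ≃σ) Φτ' τ'≃τ = Φτ' , ≃-trans {τ'} {τ} {σ} τ'≃τ τ≃σ

    module _ (ψ : Spec n k) (γ : Generalizer n k) (γ-invertible : Invertible M₀ Φ γ) where

      property3⇒gen-pruned-closed :
        ∀ {tr σ τ τ'} → Property3 M₀ Φ ψ γ tr → gen σ ∈ tr →
        τ ⊨ Φ → τ' ⊨ Φ → τ ⊨ γ σ → _≃_ M₀ τ' τ → Pruned M₀ Φ ψ γ tr τ'
      property3⇒gen-pruned-closed p3 genσ∈tr Φτ Φτ' τ⊨γσ τ'≃τ
        with σ' , τ'⊨γσ' , σ'≃σ ← proj₂ (γ-invertible _ _ Φτ' Φτ τ'≃τ) _ τ⊨γσ
        = p3 _ (Any.map sym genσ∈tr) σ' σ'≃σ _ τ'⊨γσ'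

      property3⇒property4 : ∀ tr → Property3 M₀ Φ ψ γ tr → Property4 M₀ Φ ψ γ tr
      property3⇒property4 tr p3 τ τ' Φτ Φτ' τ-pruned τ'≃τ with find τ-pruned
      ... | sol σ , solσ∈tr , τ⊨[σ] = inj₁ (lose solσ∈tr ([-]-closed {σ} τ⊨[σ] Φτ' τ'≃τ))
      ... | gen σ , genσ∈tr , τ⊨γσ =
        inj₁ (property3⇒gen-pruned-closed p3 genσ∈tr Φτ Φτ' τ⊨γσ τ'≃τ)

theorem3 : ∀ {n k} (M₀ : LTS n k) (Φ : Formula n k) (ψ : Spec n k) (γ : Generalizer n k) →
    ImpliesΔ₀ M₀ Φ →
    IsoInvariant M₀ Φ ψ →
    Proper M₀ Φ ψ γ →
    Invertible M₀ Φ γ →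
    MaintainsInvariant M₀ Φ ψ γ (Property3 M₀ Φ ψ γ) →
    MaintainsInvariant M₀ Φ ψ γ (Property4 M₀ Φ ψ γ)
theorem3 M₀ Φ ψ γ _ _ _ γ-invertible property3-invariant tr reachable =
  property3⇒property4 M₀ Φ ψ γ γ-invertible tr (property3-invariant tr reachable)
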